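{- Let $\Gamma$ be a group with identity $\varepsilon$, $\Gamma_1$ a normal subgroup, and $\mathcal A$ a collection of subgroups such that $\{\Gamma_1\}\cup\mathcal A$ partitions $\Gamma$, each $A\in\mathcal A$ is malnormal and all conjugates of members of $\mathcal A$ lie in $\mathcal A$. Let $(G,\psi)$ be a $\Gamma$-gain graph and let $e$ be a loop of $G$ at vertex $v$. (a) If $\psi(e,v,v)\in\Gamma_1\setminus\{\varepsilon\}$, then replacing $\psi(e,v,v)$ by any other element of $\Gamma_1\setminus\{\varepsilon\}$ does not change $M(\Gamma,\Gamma_1,\mathcal A,G,\psi)$. (b) If $\psi(e,v,v)\in A\setminus\{\varepsilon\}$ for some $A\in\mathcal A$, then replacing $\psi(e,v,v)$ by any other element of $A\setminus\{\varepsilon\}$ does not change $M(\Gamma,\Gamma_1,\mathcal A,G,\psi)$. (c) If $\psi(e,v,v)\in\Gamma_1\setminus\{\varepsilon\}$ and $(G',\psi')$ is obtained from $(G,\psi)$ by moving $e$ to be a loop at a different vertex $w$ with $\psi'(e,w,w)=\psi(e,v,v)$ (all else unchanged), then $M(\Gamma,\Gamma_1,\mathcal A,G',\psi')=M(\Gamma,\Gamma_1,\mathcal A,G,\psi)$.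
   Context: Conventions: graphs may have loops and parallel edges; an oriented edge is $(e,u,v)$ with $e$ having ends $u,v$; a $\Gamma$-gain function $\psi$ maps oriented edges to $\Gamma$ with $\psi(e,u,v)=\psi(e,v,u)^{ -1}$ for $u\ne v$. For a walk $W=v_1,e_1,\dots,e_k,v_{k+1}$, $\psi(W)=\prod_i\psi(e_i,v_i,v_{i+1})$; a cycle (including loops) is $\psi$-balanced if some simple closed walk around it has value $\varepsilon$. $\psi(e)$ is the set of gain values of orientations of $e$, $\psi(X)=\bigcup_{e\in X}\psi(e)$. A switching function is $\eta:V(G)\to\Gamma$, $\psi^\eta(e,u,v)=\eta(u)^{ -1}\psi(e,u,v)\eta(v)$. $\psi/\Gamma_1$ is $\psi$ composed with $\Gamma\to\Gamma/\Gamma_1$. Malnormal: $\gamma^{ -1}A\gamma\cap A=\{\varepsilon\}$ for $\gamma\notin A$; partition: each non-identity element lies in exactly one member. Frame matroid $F(G,\varphi)$: circuits are balanced cycles, tight handcuffs (two edge-disjoint cycles sharing exactly one vertex) and loose handcuffs (two vertex-disjoint cycles joined by a minimal path) with both cycles unbalanced, and theta graphs with all three cycles unbalanced. Construction: $N=F(G,\psi/\Gamma_1)$; $\mathcal C(\Gamma,\Gamma_1,\mathcal A,G,\psi)$ is the set of circuits $C$ of $N$ that are $\psi$-balanced cycles, or handcuffs or theta graphs with $\psi^\eta(C)\subseteq A$ for some switching function $\eta$ and some $A\in\mathcal A$. $M(\Gamma,\Gamma_1,\mathcal A,G,\psi)$ is the matroid on $E(G)$ with rank function $r(X)=r_N(X)$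 if every circuit of $N|X$ lies in $\mathcal C(\Gamma,\Gamma_1,\mathcal A,G,\psi)$, and $r(X)=r_N(X)+1$ otherwise. -}

module Defs where

open import Level using (Level; _⊔_) renaming (suc to lsuc)
open import Algebra.Bundles using (Group)
open import Algebra.Structures using (IsGroup; IsMonoid; IsSemigroup; IsMagma)
import Algebra.Properties.Group as GroupProps
open import Relation.Binary.Structures using (IsEquivalence)
import Relation.Binary.Reasoning.Setoid as SetoidReasoning
open import Relation.Unary using (Pred)
open import Relation.Nullary using (¬_; does)
open import Relation.Binary.PropositionalEquality using (_≡_; _≢_)
open import Data.Nat using (ℕ; _≤_)
open import Data.Fin using (Fin; _≟_)
open import Data.Fin.Subset as S using (Subset; ⁅_⁆; _∪_; _∩_; _⊆_; ∣_∣)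
open import Data.Bool using (Bool; true; false; if_then_else_)
open import Data.List using (List; []; _∷_; map; foldr)
open import Data.List.Membership.Propositional as L using ()
open import Data.List.Relation.Unary.Unique.Propositional using (Unique)
open import Data.Product using (Σ; ∃; ∃-syntax; _×_; _,_; proj₁; proj₂)
open import Data.Sum using (_⊎_; inj₁; inj₂)
open import Data.Unit using (⊤)
open import Data.Empty using (⊥)

module _ {c ℓ} (Γ : Group c ℓ) where
  open Group Γ

  record IsSubgroup {p} (H : Pred Carrier p) : Set (c ⊔ ℓ ⊔ p) where
    field
      resp     : ∀ {x y} → x ≈ y → H x → H y
      ε-closed : H ε
      ∙-closed : ∀ {x y} → H x → H y → H (x ∙ y)
      ⁻¹-closed : ∀ {x} → H x → H (x ⁻¹)

  record IsNormalSubgroup {p} (N : Pred Carrier p) : Set (c ⊔ ℓ ⊔ p) where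
    field
      isSubgroup : IsSubgroup N
      normal     : ∀ g h → N h → N (g ⁻¹ ∙ h ∙ g)
    open IsSubgroup isSubgroup public

  SameSet : ∀ {p q} → Pred Carrier p → Pred Carrier q → Set (c ⊔ p ⊔ q)
  SameSet P Q = ∀ x → (P x → Q x) × (Q x → P x)

  -- the conjugate  γ⁻¹ A γ = { γ⁻¹ a γ : a ∈ A };  x ∈ γ⁻¹Aγ iff γ x γ⁻¹ ∈ A
  Conj : ∀ {p} → Pred Carrier p → Carrier → Pred Carrier p
  Conj A γ x = A (γ ∙ x ∙ γ ⁻¹)

  Malnormal : ∀ {p} → Pred Carrier p → Set (c ⊔ ℓ ⊔ p)
  Malnormal A = ∀ γ → ¬ A γ → ∀ x → Conj A γ x → A x → x ≈ ε

  -- the collection {Γ₁} ∪ 𝒜, where 𝒜 is an indexed family of subsets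
  member : ∀ {p a} {I : Set a} → Pred Carrier p → (I → Pred Carrier p) →
           ⊤ ⊎ I → Pred Carrier p
  member Γ₁ 𝒜 (inj₁ _) = Γ₁
  member Γ₁ 𝒜 (inj₂ i) = 𝒜 i

  Partitions : ∀ {p a} {I : Set a} → Pred Carrier p → (I → Pred Carrier p) →
               Set (c ⊔ ℓ ⊔ p ⊔ a)
  Partitions {I = I} Γ₁ 𝒜 = ∀ g → ¬ (g ≈ ε) →
    (∃[ M ] member Γ₁ 𝒜 M g) ×
    (∀ M M' → member Γ₁ 𝒜 M g → member Γ₁ 𝒜 M' g →
       SameSet (member Γ₁ 𝒜 M) (member Γ₁ 𝒜 M'))

  ConjClosed : ∀ {p a} {I : Set a} → (I → Pred Carrier p) → Set (c ⊔ p ⊔ a)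
  ConjClosed {I = I} 𝒜 = ∀ i γ → ∃[ j ] SameSet (Conj (𝒜 i) γ) (𝒜 j)

module Quotient {c ℓ p} (Γ : Group c ℓ) (N : Pred (Group.Carrier Γ) p)
                (isN : IsNormalSubgroup Γ N) where
  open Group Γ
  open IsNormalSubgroup isN
  open GroupProps Γ
  open SetoidReasoning setoid

  _∼_ : Carrier → Carrier → Set p
  x ∼ y = N (x ⁻¹ ∙ y)

  cancelˡ : ∀ y z → y ∙ (y ⁻¹ ∙ z) ≈ z
  cancelˡ y z = begin
    y ∙ (y ⁻¹ ∙ z) ≈⟨ sym (assoc _ _ _) ⟩
    y ∙ y ⁻¹ ∙ z   ≈⟨ ∙-congʳ (inverseʳ y) ⟩
    ε ∙ z          ≈⟨ identityˡ z ⟩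
    z ∎

  ∼-refl : ∀ {x} → x ∼ x
  ∼-refl {x} = resp (sym (inverseˡ x)) ε-closed

  ≈⇒∼ : ∀ {x y} → x ≈ y → x ∼ y
  ≈⇒∼ {x} {y} eq = resp (∙-congˡ eq) (∼-refl {x})

  ∼-sym : ∀ {x y} → x ∼ y → y ∼ x
  ∼-sym {x} {y} h = resp eq (⁻¹-closed h)
    where
    eq : (x ⁻¹ ∙ y) ⁻¹ ≈ y ⁻¹ ∙ x
    eq = begin
      (x ⁻¹ ∙ y) ⁻¹     ≈⟨ ⁻¹-anti-homo-∙ _ _ ⟩
      y ⁻¹ ∙ x ⁻¹ ⁻¹    ≈⟨ ∙-congˡ (⁻¹-involutive x) ⟩
      y ⁻¹ ∙ x ∎

  ∼-trans : ∀ {x y z} → x ∼ y → y ∼ z → x ∼ z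
  ∼-trans {x} {y} {z} h k = resp eq (∙-closed h k)
    where
    eq : x ⁻¹ ∙ y ∙ (y ⁻¹ ∙ z) ≈ x ⁻¹ ∙ z
    eq = begin
      x ⁻¹ ∙ y ∙ (y ⁻¹ ∙ z)   ≈⟨ assoc _ _ _ ⟩
      x ⁻¹ ∙ (y ∙ (y ⁻¹ ∙ z)) ≈⟨ ∙-congˡ (cancelˡ y z) ⟩
      x ⁻¹ ∙ z ∎

  ∼-∙-cong : ∀ {x x' y y'} → x ∼ x' → y ∼ y' → (x ∙ y) ∼ (x' ∙ y')
  ∼-∙-cong {x} {x'} {y} {y'} h k =
    resp eq (∙-closed (normal y (x ⁻¹ ∙ x') h) k)
    where
    eq : y ⁻¹ ∙ (x ⁻¹ ∙ x') ∙ y ∙ (y ⁻¹ ∙ y') ≈ (x ∙ y) ⁻¹ ∙ (x' ∙ y')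
    eq = begin
      y ⁻¹ ∙ (x ⁻¹ ∙ x') ∙ y ∙ (y ⁻¹ ∙ y')   ≈⟨ assoc _ _ _ ⟩
      y ⁻¹ ∙ (x ⁻¹ ∙ x') ∙ (y ∙ (y ⁻¹ ∙ y')) ≈⟨ ∙-congˡ (cancelˡ y y') ⟩
      y ⁻¹ ∙ (x ⁻¹ ∙ x') ∙ y'                ≈⟨ assoc _ _ _ ⟩
      y ⁻¹ ∙ (x ⁻¹ ∙ x' ∙ y')                ≈⟨ ∙-congˡ (assoc _ _ _) ⟩
      y ⁻¹ ∙ (x ⁻¹ ∙ (x' ∙ y'))              ≈⟨ sym (assoc _ _ _) ⟩
      y ⁻¹ ∙ x ⁻¹ ∙ (x' ∙ y')                ≈⟨ ∙-congʳ (sym (⁻¹-anti-homo-∙ x y)) ⟩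
      (x ∙ y) ⁻¹ ∙ (x' ∙ y') ∎

  ∼-⁻¹-cong : ∀ {x y} → x ∼ y → (x ⁻¹) ∼ (y ⁻¹)
  ∼-⁻¹-cong {x} {y} h = resp eq (normal (x ⁻¹) _ (∼-sym h))
    where
    eq : x ⁻¹ ⁻¹ ∙ (y ⁻¹ ∙ x) ∙ x ⁻¹ ≈ x ⁻¹ ⁻¹ ∙ y ⁻¹
    eq = begin
      x ⁻¹ ⁻¹ ∙ (y ⁻¹ ∙ x) ∙ x ⁻¹   ≈⟨ assoc _ _ _ ⟩
      x ⁻¹ ⁻¹ ∙ (y ⁻¹ ∙ x ∙ x ⁻¹)   ≈⟨ ∙-congˡ (assoc _ _ _) ⟩
      x ⁻¹ ⁻¹ ∙ (y ⁻¹ ∙ (x ∙ x ⁻¹)) ≈⟨ ∙-congˡ (∙-congˡ (inverseʳ x)) ⟩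
      x ⁻¹ ⁻¹ ∙ (y ⁻¹ ∙ ε)          ≈⟨ ∙-congˡ (identityʳ _) ⟩
      x ⁻¹ ⁻¹ ∙ y ⁻¹ ∎

  quotientGroup : Group c p
  quotientGroup = record
    { Carrier = Carrier
    ; _≈_ = _∼_
    ; _∙_ = _∙_
    ; ε = ε
    ; _⁻¹ = _⁻¹
    ; isGroup = record
      { isMonoid = record
        { isSemigroup = record
          { isMagma = record
            { isEquivalence = record { refl = ∼-refl ; sym = ∼-sym ; trans = ∼-trans }
            ; ∙-cong = ∼-∙-cong }
          ; assoc = λ x y z → ≈⇒∼ (assoc x y z) }
        ; identity = (λ x → ≈⇒∼ (identityˡ x)) , (λ x → ≈⇒∼ (identityʳ x)) }
      ; inverse = (λ x → ≈⇒∼ (inverseˡ x)) , (λ x → ≈⇒∼ (inverseʳ x))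
      ; ⁻¹-cong = ∼-⁻¹-cong }
    }

record Graph (n m : ℕ) : Set where
  constructor graph
  field
    end₁ end₂ : Fin m → Fin n

-- a traversal of an edge: (e , true) goes end₁ e → end₂ e,
-- (e , false) goes end₂ e → end₁ e.  For a loop both denote the
-- single oriented edge (e , v , v).
Step : ℕ → Set
Step m = Fin m × Bool

module GraphNotions {n m : ℕ} (G : Graph n m) where
  open Graph G

  tl hd : Step m → Fin n
  tl (e , true)  = end₁ e
  tl (e , false) = end₂ e
  hd (e , true)  = end₂ e
  hd (e , false) = end₁ e

  IsLoopAt : Fin m → Fin n → Set
  IsLoopAt e v = end₁ e ≡ v × end₂ e ≡ v

  WalkFrom : Fin n → List (Step m) → Fin n → Set
  WalkFrom x []      y = x ≡ y
  WalkFrom x (s ∷ W) y = tl s ≡ x × WalkFrom (hd s) W y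

  edgesOf : List (Step m) → Subset m
  edgesOf []      = S.⊥
  edgesOf (s ∷ W) = ⁅ proj₁ s ⁆ ∪ edgesOf W

  vertsOf : Fin n → List (Step m) → List (Fin n)
  vertsOf x W = x ∷ map hd W

  SimpleClosedWalk : Fin n → List (Step m) → Set
  SimpleClosedWalk v W = (W ≢ []) × WalkFrom v W v ×
                         Unique (map proj₁ W) × Unique (map tl W)

  IsCycle : Subset m → Set
  IsCycle X = ∃[ v ] ∃[ W ] SimpleClosedWalk v W × X ≡ edgesOf W

  SimplePath : Fin n → List (Step m) → Fin n → Set
  SimplePath x P y = WalkFrom x P y × Unique (vertsOf x P)

  Incident : Subset m → Fin n → Set
  Incident X u = ∃[ e ] e S.∈ X × (end₁ e ≡ u ⊎ end₂ e ≡ u)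

  EdgeDisjoint : Subset m → Subset m → Set
  EdgeDisjoint X Y = ∀ e → e S.∈ X → e S.∈ Y → ⊥

  TightHandcuff : Subset m → Subset m → Subset m → Set
  TightHandcuff C₁ C₂ X =
    IsCycle C₁ × IsCycle C₂ × EdgeDisjoint C₁ C₂ ×
    (∃[ v ] Incident C₁ v × Incident C₂ v ×
       (∀ u → Incident C₁ u → Incident C₂ u → u ≡ v)) ×
    X ≡ C₁ ∪ C₂

  LooseHandcuff : Subset m → Subset m → Subset m → Set
  LooseHandcuff C₁ C₂ X =
    IsCycle C₁ × IsCycle C₂ × (∀ u → Incident C₁ u → Incident C₂ u → ⊥) ×
    (∃[ x ] ∃[ P ] ∃[ y ] SimplePath x P y × Incident C₁ x × Incident C₂ y ×
       (∀ u → u L.∈ vertsOf x P → Incident C₁ u → u ≡ x) ×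
       (∀ u → u L.∈ vertsOf x P → Incident C₂ u → u ≡ y) ×
       X ≡ C₁ ∪ C₂ ∪ edgesOf P)

  Handcuff : Subset m → Subset m → Subset m → Set
  Handcuff C₁ C₂ X = TightHandcuff C₁ C₂ X ⊎ LooseHandcuff C₁ C₂ X

  InternallyDisjoint : Fin n → Fin n → List (Step m) → List (Step m) → Set
  InternallyDisjoint x y P Q =
    EdgeDisjoint (edgesOf P) (edgesOf Q) ×
    (∀ u → u L.∈ vertsOf x P → u L.∈ vertsOf x Q → u ≡ x ⊎ u ≡ y)

  Theta : Fin n → Fin n → List (Step m) → List (Step m) → List (Step m) →
          Subset m → Set
  Theta x y P₁ P₂ P₃ X =
    x ≢ y × SimplePath x P₁ y × SimplePath x P₂ y × SimplePath x P₃ y ×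
    InternallyDisjoint x y P₁ P₂ × InternallyDisjoint x y P₁ P₃ ×
    InternallyDisjoint x y P₂ P₃ ×
    X ≡ edgesOf P₁ ∪ edgesOf P₂ ∪ edgesOf P₃

  IsHandcuff : Subset m → Set
  IsHandcuff X = ∃[ C₁ ] ∃[ C₂ ] Handcuff C₁ C₂ X

  IsTheta : Subset m → Set
  IsTheta X = ∃[ x ] ∃[ y ] ∃[ P₁ ] ∃[ P₂ ] ∃[ P₃ ] Theta x y P₁ P₂ P₃ X

-- A K-gain function on G is represented by  φ : Fin m → Carrier,
-- φ e = ψ(e, end₁ e, end₂ e); then ψ(e, end₂ e, end₁ e) = (φ e)⁻¹ for
-- non-loops, and a loop has the single oriented edge (e, v, v).
module GainNotions {c ℓ} (K : Group c ℓ) {n m : ℕ} (G : Graph n m) where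
  open Group K
  open Graph G
  open GraphNotions G

  gain : (Fin m → Carrier) → Step m → Carrier
  gain φ (e , true)  = φ e
  gain φ (e , false) = if does (end₁ e ≟ end₂ e) then φ e else φ e ⁻¹

  walkGain : (Fin m → Carrier) → List (Step m) → Carrier
  walkGain φ = foldr (λ s g → gain φ s ∙ g) ε

  Balanced : (Fin m → Carrier) → Subset m → Set ℓ
  Balanced φ X = ∃[ v ] ∃[ W ] SimpleClosedWalk v W × X ≡ edgesOf W ×
                 walkGain φ W ≈ ε

  FrameCircuit : (Fin m → Carrier) → Subset m → Set ℓ
  FrameCircuit φ X =
    (IsCycle X × Balanced φ X) ⊎
    (∃[ C₁ ] ∃[ C₂ ] Handcuff C₁ C₂ X × ¬ Balanced φ C₁ × ¬ Balanced φ C₂) ⊎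
    (∃[ x ] ∃[ y ] ∃[ P₁ ] ∃[ P₂ ] ∃[ P₃ ] Theta x y P₁ P₂ P₃ X ×
       ¬ Balanced φ (edgesOf P₁ ∪ edgesOf P₂) ×
       ¬ Balanced φ (edgesOf P₁ ∪ edgesOf P₃) ×
       ¬ Balanced φ (edgesOf P₂ ∪ edgesOf P₃))

  switchedGain : (Fin m → Carrier) → (Fin n → Carrier) → Step m → Carrier
  switchedGain φ η s = η (tl s) ⁻¹ ∙ gain φ s ∙ η (hd s)

  SwitchedInto : ∀ {p} → (Fin m → Carrier) → (Fin n → Carrier) →
                 Subset m → Pred Carrier p → Set p
  SwitchedInto φ η X A = ∀ e → e S.∈ X → ∀ d → A (switchedGain φ η (e , d))

module _ {m : ℕ} {q} (Circuit : Subset m → Set q) where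
  Independent : Subset m → Set q
  Independent Y = ∀ C → Circuit C → C ⊆ Y → ⊥

  IsRank : Subset m → ℕ → Set q
  IsRank X k = (∃[ Y ] Y ⊆ X × Independent Y × ∣ Y ∣ ≡ k) ×
               (∀ Y → Y ⊆ X → Independent Y → ∣ Y ∣ ≤ k)

module MNotions {c ℓ p a} (Γ : Group c ℓ) (Γ₁ : Pred (Group.Carrier Γ) p)
                (isN : IsNormalSubgroup Γ Γ₁)
                {I : Set a} (𝒜 : I → Pred (Group.Carrier Γ) p)
                {n m : ℕ} (G : Graph n m) (ψ : Fin m → Group.Carrier Γ) where
  open Group Γ
  open GraphNotions G
  open Quotient Γ Γ₁ isN using (quotientGroup)
  module Gψ = GainNotions Γ G
  module GQ = GainNotions quotientGroup G

  -- circuits of N = F(G, ψ/Γ₁)  (ψ/Γ₁ has the same underlying function)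
  NCircuit : Subset m → Set p
  NCircuit = GQ.FrameCircuit ψ

  𝒞 : Subset m → Set (c ⊔ ℓ ⊔ p ⊔ a)
  𝒞 X = NCircuit X ×
        ((IsCycle X × Gψ.Balanced ψ X) ⊎
         ((IsHandcuff X ⊎ IsTheta X) ×
          ∃[ η ] ∃[ i ] Gψ.SwitchedInto ψ η X (𝒜 i)))

  AllCircuitsIn𝒞 : Subset m → Set (c ⊔ ℓ ⊔ p ⊔ a)
  AllCircuitsIn𝒞 X = ∀ C → NCircuit C → C ⊆ X → 𝒞 C

  RankM : Subset m → ℕ → Set (c ⊔ ℓ ⊔ p ⊔ a)
  RankM X k =
    (AllCircuitsIn𝒞 X × IsRank NCircuit X k) ⊎
    (¬ AllCircuitsIn𝒞 X × ∃[ j ] IsRank NCircuit X j × k ≡ Data.Nat.suc j)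

SameM : ∀ {c ℓ p a} (Γ : Group c ℓ) (Γ₁ : Pred (Group.Carrier Γ) p)
        (isN : IsNormalSubgroup Γ Γ₁) {I : Set a} (𝒜 : I → Pred (Group.Carrier Γ) p)
        {n m : ℕ} → (G : Graph n m) → (ψ : Fin m → Group.Carrier Γ) →
        (G' : Graph n m) → (ψ' : Fin m → Group.Carrier Γ) → Set (c ⊔ ℓ ⊔ p ⊔ a)
SameM Γ Γ₁ isN 𝒜 G ψ G' ψ' =
  ∀ X k → (MNotions.RankM Γ Γ₁ isN 𝒜 G ψ X k → MNotions.RankM Γ Γ₁ isN 𝒜 G' ψ' X k) ×
          (MNotions.RankM Γ Γ₁ isN 𝒜 G' ψ' X k → MNotions.RankM Γ Γ₁ isN 𝒜 G ψ X k)

replaceGain : ∀ {c} {A : Set c} {m} → (Fin m → A) → Fin m → A → Fin m → A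
replaceGain ψ e g f = if does (f ≟ e) then g else ψ f

moveToLoop : ∀ {n m} → Graph n m → Fin m → Fin n → Graph n m
moveToLoop G e w = graph (λ f → if does (f ≟ e) then w else Graph.end₁ G f)
                         (λ f → if does (f ≟ e) then w else Graph.end₂ G f)

{-# OPTIONS --safe #-}
module Submission where

-- A loop e at v is a cycle on its own and lies on no path, so a circuit of
-- N = F(G, ψ/Γ₁) through e is either the cycle {e} or a handcuff having {e} as
-- one of its cycles.  Whether such a set is a circuit of N, and whether it lies
-- in 𝒞, depends on ψ(e) only through which of Γ₁, {ε} and the conjugates of the
-- members of 𝒜 contain it; two non-identity elements of one block of the
-- partition {Γ₁} ∪ 𝒜 cannot be told apart this way (for a block of 𝒜 because 𝒜
-- is closed under conjugation).  For (c), a loop with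
-- gain in Γ₁ is balanced in N, so the only circuit of N through it is {e}
-- itself, and every other circuit of N avoids e and does not see where e is
-- attached.

open import Defs
open import Level using (_⊔_)
open import Algebra.Bundles using (Group)
import Algebra.Properties.Group as GroupProperties
import Relation.Binary.Reasoning.Setoid as SetoidReasoning
open import Function.Base using (_∘_; id)
open import Function.Bundles using (_⇔_; mk⇔; Equivalence)
open import Function.Construct.Symmetry using (⇔-sym)
open import Relation.Unary using (Pred)
open import Relation.Nullary using (¬_; does; yes; no)
open import Relation.Nullary.Decidable using (dec-true; dec-false)
open import Relation.Binary.PropositionalEquality
  using (_≡_; _≢_; refl; sym; trans; cong; cong₂; subst; subst₂)
open import Data.Nat using (ℕ)
open import Data.Empty using (⊥; ⊥-elim)
open import Data.Unit using (tt)
open import Data.Bool using (true; false; if_then_else_)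
open import Data.Fin using (Fin; _≟_)
open import Data.Fin.Subset as S using (Subset; ⁅_⁆; _∪_; _⊆_; Nonempty)
open import Data.Fin.Subset.Properties
  using (x∈p∪q⁻; p⊆p∪q; q⊆p∪q; x∈⁅x⁆; x∈⁅y⁆⇒x≡y; ∉⊥; _∈?_)
open import Data.List using ([]; _∷_; map)
open import Data.List.Membership.Propositional as L using ()
open import Data.List.Relation.Unary.All as All using (All; []; _∷_)
open import Data.List.Relation.Unary.Any using (here; there)
open import Data.List.Relation.Unary.AllPairs using ([]; _∷_)
open import Data.List.Relation.Unary.Unique.Propositional using (Unique)
open import Data.Product using (∃-syntax; _×_; _,_; proj₁; proj₂)
open import Data.Sum as Sum using (_⊎_; inj₁; inj₂)

open Equivalence using (to; from)

∉-∪ : ∀ {k} {x : Fin k} {p q : Subset k} → x S.∉ p → x S.∉ q → x S.∉ p ∪ q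
∉-∪ {p = p} {q} x∉p x∉q x∈p∪q = Sum.[ x∉p , x∉q ]′ (x∈p∪q⁻ p q x∈p∪q)

∈∧∉⇒≢ : ∀ {k} {x y : Fin k} {p : Subset k} → x S.∈ p → y S.∉ p → x ≢ y
∈∧∉⇒≢ x∈p y∉p refl = y∉p x∈p

⊆⁅⁆⇒∈ : ∀ {k} {x : Fin k} {p : Subset k} → Nonempty p → p ⊆ ⁅ x ⁆ → x S.∈ p
⊆⁅⁆⇒∈ (y , y∈p) p⊆x = subst (S._∈ _) (x∈⁅y⁆⇒x≡y _ (p⊆x y∈p)) y∈p

edgesOf-indep : ∀ {n m} (G G′ : Graph n m) W →
                GraphNotions.edgesOf G W ≡ GraphNotions.edgesOf G′ W
edgesOf-indep G G′ []      = refl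
edgesOf-indep G G′ (s ∷ W) = cong (⁅ proj₁ s ⁆ ∪_) (edgesOf-indep G G′ W)

module GraphProperties {n m} (G : Graph n m) where
  open Graph G
  open GraphNotions G

  ∈-edgesOf-∷⁻ : ∀ s W {f} → f S.∈ edgesOf (s ∷ W) → f ≡ proj₁ s ⊎ f S.∈ edgesOf W
  ∈-edgesOf-∷⁻ s W f∈ = Sum.map₁ (x∈⁅y⁆⇒x≡y _) (x∈p∪q⁻ ⁅ proj₁ s ⁆ (edgesOf W) f∈)

  edgesOf-head : ∀ s W → proj₁ s S.∈ edgesOf (s ∷ W)
  edgesOf-head s W = p⊆p∪q (edgesOf W) (x∈⁅x⁆ (proj₁ s))

  edgesOf-singleton : ∀ s → edgesOf (s ∷ []) ⊆ ⁅ proj₁ s ⁆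
  edgesOf-singleton s f∈ = Sum.[ id , ⊥-elim ∘ ∉⊥ ]′ (x∈p∪q⁻ _ _ f∈)

  cycle-nonempty : ∀ {C} → IsCycle C → Nonempty C
  cycle-nonempty (_ , []    , (W≢[] , _) , _)    = ⊥-elim (W≢[] refl)
  cycle-nonempty (_ , s ∷ W , _          , refl) = proj₁ s , edgesOf-head s W

  walk-nonempty : ∀ {x y} P → x ≢ y → WalkFrom x P y → Nonempty (edgesOf P)
  walk-nonempty []      x≢y x≡y = ⊥-elim (x≢y x≡y)
  walk-nonempty (s ∷ P) _   _   = proj₁ s , edgesOf-head s P

  handcuff-cycles : ∀ {C₁ C₂ X} → Handcuff C₁ C₂ X → IsCycle C₁ × IsCycle C₂
  handcuff-cycles (inj₁ (cyc₁ , cyc₂ , _)) = cyc₁ , cyc₂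
  handcuff-cycles (inj₂ (cyc₁ , cyc₂ , _)) = cyc₁ , cyc₂

  handcuff-⊆ : ∀ {C₁ C₂ X} → Handcuff C₁ C₂ X → C₁ ⊆ X × C₂ ⊆ X
  handcuff-⊆ {C₁} {C₂} (inj₁ (_ , _ , _ , _ , refl)) = p⊆p∪q C₂ , q⊆p∪q C₁ C₂
  handcuff-⊆ {C₁} {C₂} (inj₂ (_ , _ , _ , _ , P , _ , _ , _ , _ , _ , _ , refl)) =
    p⊆p∪q _ , q⊆p∪q C₁ _ ∘ p⊆p∪q (edgesOf P)

  handcuff-⊆⁅⁆⇒∈ : ∀ {C₁ C₂ X f} → Handcuff C₁ C₂ X → X ⊆ ⁅ f ⁆ → f S.∈ C₁ × f S.∈ C₂
  handcuff-⊆⁅⁆⇒∈ hc X⊆f =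
    ⊆⁅⁆⇒∈ (cycle-nonempty (proj₁ (handcuff-cycles hc))) (X⊆f ∘ proj₁ (handcuff-⊆ hc)) ,
    ⊆⁅⁆⇒∈ (cycle-nonempty (proj₂ (handcuff-cycles hc))) (X⊆f ∘ proj₂ (handcuff-⊆ hc))

  handcuff-⊈⁅⁆ : ∀ {C₁ C₂ X f} → Handcuff C₁ C₂ X → ¬ X ⊆ ⁅ f ⁆
  handcuff-⊈⁅⁆ {f = f} hc@(inj₁ (_ , _ , edge-disjoint , _)) X⊆f =
    edge-disjoint f (proj₁ (handcuff-⊆⁅⁆⇒∈ hc X⊆f)) (proj₂ (handcuff-⊆⁅⁆⇒∈ hc X⊆f))
  handcuff-⊈⁅⁆ {f = f} hc@(inj₂ (_ , _ , vertex-disjoint , _)) X⊆f =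
    vertex-disjoint (end₁ f) (f , proj₁ (handcuff-⊆⁅⁆⇒∈ hc X⊆f) , inj₁ refl)
                             (f , proj₂ (handcuff-⊆⁅⁆⇒∈ hc X⊆f) , inj₁ refl)

  theta-⊈⁅⁆ : ∀ {x y P₁ P₂ P₃ X f} → Theta x y P₁ P₂ P₃ X → ¬ X ⊆ ⁅ f ⁆
  theta-⊈⁅⁆ {P₁ = P₁} {P₂} {P₃}
    (x≢y , (walk₁ , _) , (walk₂ , _) , _ , (edge-disjoint , _) , _ , _ , refl) X⊆f =
    edge-disjoint _
      (⊆⁅⁆⇒∈ (walk-nonempty P₁ x≢y walk₁) (X⊆f ∘ p⊆p∪q _))
      (⊆⁅⁆⇒∈ (walk-nonempty P₂ x≢y walk₂) (X⊆f ∘ q⊆p∪q (edgesOf P₁) _ ∘ p⊆p∪q (edgesOf P₃)))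

  module Loop {e v} (loop : IsLoopAt e v) where

    tl-loop : ∀ d → tl (e , d) ≡ v
    tl-loop true  = proj₁ loop
    tl-loop false = proj₂ loop

    hd-loop : ∀ d → hd (e , d) ≡ v
    hd-loop true  = proj₂ loop
    hd-loop false = proj₁ loop

    loop-closedWalk : ∀ d → SimpleClosedWalk v ((e , d) ∷ [])
    loop-closedWalk d = (λ ()) , (tl-loop d , hd-loop d) , ([] ∷ []) , ([] ∷ [])

    loop∈⇒v∈tails : ∀ W → e S.∈ edgesOf W → v L.∈ map tl W
    loop∈⇒v∈tails []            e∈ = ⊥-elim (∉⊥ e∈)
    loop∈⇒v∈tails ((f , d) ∷ W) e∈ with ∈-edgesOf-∷⁻ (f , d) W e∈
    ... | inj₁ refl = here (sym (tl-loop d))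
    ... | inj₂ e∈W  = there (loop∈⇒v∈tails W e∈W)

    loop∈⇒v∈later-tails : ∀ {x y} s s′ W → WalkFrom x (s ∷ s′ ∷ W) y →
                          e S.∈ edgesOf (s ∷ s′ ∷ W) → v L.∈ map tl (s′ ∷ W)
    loop∈⇒v∈later-tails (f , d) s′ W (_ , tl≡hd , _) e∈ with ∈-edgesOf-∷⁻ (f , d) (s′ ∷ W) e∈
    ... | inj₁ refl  = here (sym (trans tl≡hd (hd-loop d)))
    ... | inj₂ e∈s′W = loop∈⇒v∈tails (s′ ∷ W) e∈s′W

    -- a step after the loop would repeat the tail v
    loop-ends-walk : ∀ {x y} W → WalkFrom x W y → Unique (map tl W) → e S.∈ edgesOf W → y ≡ v
    loop-ends-walk []            _          _              e∈ = ⊥-elim (∉⊥ e∈)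
    loop-ends-walk ((f , d) ∷ W) (_ , walk) (tl∉ ∷ unique) e∈ with ∈-edgesOf-∷⁻ (f , d) W e∈
    ... | inj₂ e∈W  = loop-ends-walk W walk unique e∈W
    ... | inj₁ refl = last W walk tl∉
      where
      last : ∀ {y} W → WalkFrom (hd (e , d)) W y → All (tl (e , d) ≢_) (map tl W) → y ≡ v
      last []      hd≡y        _         = trans (sym hd≡y) (hd-loop d)
      last (_ ∷ _) (tl≡hd , _) (tl≢ ∷ _) =
        ⊥-elim (tl≢ (trans (tl-loop d) (sym (trans tl≡hd (hd-loop d)))))

    closedWalk-through-loop : ∀ {u} W → SimpleClosedWalk u W → e S.∈ edgesOf W →
                              ∃[ d ] W ≡ (e , d) ∷ []
    closedWalk-through-loop [] (W≢[] , _) _ = ⊥-elim (W≢[] refl)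
    closedWalk-through-loop ((f , d) ∷ []) _ e∈ with ∈-edgesOf-∷⁻ (f , d) [] e∈
    ... | inj₁ refl = d , refl
    ... | inj₂ e∈[] = ⊥-elim (∉⊥ e∈[])
    -- the walk starts where it ends, at v, and v recurs as a later tail
    closedWalk-through-loop (s ∷ s′ ∷ W) (_ , walk , _ , unique@(tl∉ ∷ _)) e∈ =
      ⊥-elim (All.lookup tl∉ (loop∈⇒v∈later-tails s s′ W walk e∈)
                         (trans (proj₁ walk) (loop-ends-walk (s ∷ s′ ∷ W) walk unique e∈)))

    cycle-through-loop : ∀ {C} → IsCycle C → e S.∈ C → C ⊆ ⁅ e ⁆
    cycle-through-loop (_ , W , closed , refl) e∈ with closedWalk-through-loop W closed e∈
    ... | d , refl = edgesOf-singleton (e , d)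

    simplePath-avoids-loop : ∀ {x y} P → SimplePath x P y → e S.∉ edgesOf P
    simplePath-avoids-loop [] _ e∈ = ∉⊥ e∈
    simplePath-avoids-loop ((f , d) ∷ P) ((tl≡x , walk) , x∉ ∷ unique) e∈
      with ∈-edgesOf-∷⁻ (f , d) P e∈
    ... | inj₁ refl = All.head x∉ (trans (sym tl≡x) (trans (tl-loop d) (sym (hd-loop d))))
    ... | inj₂ e∈P  = simplePath-avoids-loop P (walk , unique) e∈P

    handcuff-avoids-loop : ∀ {C₁ C₂ X} → Handcuff C₁ C₂ X → e S.∉ C₁ → e S.∉ C₂ → e S.∉ X
    handcuff-avoids-loop (inj₁ (_ , _ , _ , _ , refl)) e∉C₁ e∉C₂ = ∉-∪ e∉C₁ e∉C₂
    handcuff-avoids-loop (inj₂ (_ , _ , _ , _ , P , _ , path , _ , _ , _ , _ , refl)) e∉C₁ e∉C₂ =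
      ∉-∪ e∉C₁ (∉-∪ e∉C₂ (simplePath-avoids-loop P path))

    theta-avoids-loop : ∀ {x y P₁ P₂ P₃ X} → Theta x y P₁ P₂ P₃ X → e S.∉ X
    theta-avoids-loop {P₁ = P₁} {P₂} {P₃} (_ , path₁ , path₂ , path₃ , _ , _ , _ , refl) =
      ∉-∪ (simplePath-avoids-loop P₁ path₁)
          (∉-∪ (simplePath-avoids-loop P₂ path₂) (simplePath-avoids-loop P₃ path₃))

    module _ {c ℓ} (K : Group c ℓ) where
      open Group K using (Carrier; _≈_; _∙_; _⁻¹; ε; identityʳ)
        renaming (trans to ≈-trans; reflexive to ≈-reflexive)
      open GainNotions K G

      gain-loop : ∀ φ d → gain φ (e , d) ≡ φ e
      gain-loop φ true  = refl
      gain-loop φ false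
        rewrite dec-true (end₁ e ≟ end₂ e) (trans (proj₁ loop) (sym (proj₂ loop))) = refl

      walkGain-loop : ∀ φ d → walkGain φ ((e , d) ∷ []) ≈ φ e
      walkGain-loop φ d = ≈-trans (identityʳ _) (≈-reflexive (gain-loop φ d))

      switchedGain-loop : ∀ φ η d → switchedGain φ η (e , d) ≡ η v ⁻¹ ∙ φ e ∙ η v
      switchedGain-loop φ η d rewrite tl-loop d | hd-loop d | gain-loop φ d = refl

      cycle-through-loop-balanced : ∀ {φ C} → φ e ≈ ε → IsCycle C → e S.∈ C → Balanced φ C
      cycle-through-loop-balanced {φ} φe≈ε (u , W , closed , refl) e∈
        with closedWalk-through-loop W closed e∈
      ... | d , refl = u , _ , closed , refl , ≈-trans (walkGain-loop φ d) φe≈ε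

replaceGain-at : ∀ {c} {A : Set c} {m} (ψ : Fin m → A) e g → replaceGain ψ e g e ≡ g
replaceGain-at ψ e g rewrite dec-true (e ≟ e) refl = refl

replaceGain-elsewhere : ∀ {c} {A : Set c} {m} (ψ : Fin m → A) e g f →
                        f ≢ e → ψ f ≡ replaceGain ψ e g f
replaceGain-elsewhere ψ e g f f≢e rewrite dec-false (f ≟ e) f≢e = refl

record LoopRelocation {n m} (G G′ : Graph n m) (e : Fin m) (v w : Fin n) : Set where
  field
    loop       : GraphNotions.IsLoopAt G e v
    loop′      : GraphNotions.IsLoopAt G′ e w
    end₁-agree : ∀ f → f ≢ e → Graph.end₁ G f ≡ Graph.end₁ G′ f
    end₂-agree : ∀ f → f ≢ e → Graph.end₂ G f ≡ Graph.end₂ G′ f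

LoopRelocation-refl : ∀ {n m} {G : Graph n m} {e v} →
                      GraphNotions.IsLoopAt G e v → LoopRelocation G G e v v
LoopRelocation-refl loop = record
  { loop = loop ; loop′ = loop ; end₁-agree = λ _ _ → refl ; end₂-agree = λ _ _ → refl }

LoopRelocation-sym : ∀ {n m} {G G′ : Graph n m} {e v w} →
                     LoopRelocation G G′ e v w → LoopRelocation G′ G e w v
LoopRelocation-sym R = record
  { loop       = loop′
  ; loop′      = loop
  ; end₁-agree = λ f f≢e → sym (end₁-agree f f≢e)
  ; end₂-agree = λ f f≢e → sym (end₂-agree f f≢e)
  } where open LoopRelocation R

moveToLoop-relocation : ∀ {n m} {G : Graph n m} {e v} → GraphNotions.IsLoopAt G e v →
                        ∀ w → LoopRelocation G (moveToLoop G e w) e v w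
moveToLoop-relocation {G = G} {e} loop w = record
  { loop       = loop
  ; loop′      = moved-end , moved-end
  ; end₁-agree = λ f f≢e → sym (unmoved-end f≢e)
  ; end₂-agree = λ f f≢e → sym (unmoved-end f≢e)
  }
  where
  moved-end : ∀ {a} → (if does (e ≟ e) then w else a) ≡ w
  moved-end rewrite dec-true (e ≟ e) refl = refl
  unmoved-end : ∀ {f a} → f ≢ e → (if does (f ≟ e) then w else a) ≡ a
  unmoved-end {f = f} f≢e rewrite dec-false (f ≟ e) f≢e = refl

module Relocation {n m} {G G′ : Graph n m} {e v w} (R : LoopRelocation G G′ e v w) where
  open LoopRelocation R
  private
    module Old = GraphNotions G
    module New = GraphNotions G′
    module OldLoop = GraphProperties.Loop G loop
    module NewLoop = GraphProperties.Loop G′ loop′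

  tl-agree : ∀ s → proj₁ s ≢ e → Old.tl s ≡ New.tl s
  tl-agree (f , true)  f≢e = end₁-agree f f≢e
  tl-agree (f , false) f≢e = end₂-agree f f≢e

  hd-agree : ∀ s → proj₁ s ≢ e → Old.hd s ≡ New.hd s
  hd-agree (f , true)  f≢e = end₂-agree f f≢e
  hd-agree (f , false) f≢e = end₁-agree f f≢e

  head≢loop : ∀ s W → e S.∉ Old.edgesOf (s ∷ W) → proj₁ s ≢ e
  head≢loop s W e∉ = ∈∧∉⇒≢ (GraphProperties.edgesOf-head G s W) e∉

  tail-avoids : ∀ s W → e S.∉ Old.edgesOf (s ∷ W) → e S.∉ Old.edgesOf W
  tail-avoids s W e∉ = e∉ ∘ q⊆p∪q _ _

  tails-agree : ∀ W → e S.∉ Old.edgesOf W → map Old.tl W ≡ map New.tl W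
  tails-agree []      _  = refl
  tails-agree (s ∷ W) e∉ =
    cong₂ _∷_ (tl-agree s (head≢loop s W e∉)) (tails-agree W (tail-avoids s W e∉))

  heads-agree : ∀ W → e S.∉ Old.edgesOf W → map Old.hd W ≡ map New.hd W
  heads-agree []      _  = refl
  heads-agree (s ∷ W) e∉ =
    cong₂ _∷_ (hd-agree s (head≢loop s W e∉)) (heads-agree W (tail-avoids s W e∉))

  walk-transport : ∀ {x y} W → e S.∉ Old.edgesOf W → Old.WalkFrom x W y → New.WalkFrom x W y
  walk-transport []      _  x≡y           = x≡y
  walk-transport (s ∷ W) e∉ (tl≡x , walk) =
    trans (sym (tl-agree s (head≢loop s W e∉))) tl≡x ,
    subst (λ z → New.WalkFrom z W _) (hd-agree s (head≢loop s W e∉))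
          (walk-transport W (tail-avoids s W e∉) walk)

  closedWalk-transport : ∀ {u} W → Old.SimpleClosedWalk u W → ∃[ u′ ] New.SimpleClosedWalk u′ W
  closedWalk-transport W closed@(W≢[] , walk , edges-unique , tails-unique)
    with e ∈? Old.edgesOf W
  ... | no e∉W = _ , W≢[] , walk-transport W e∉W walk , edges-unique ,
                 subst Unique (tails-agree W e∉W) tails-unique
  ... | yes e∈W with OldLoop.closedWalk-through-loop W closed e∈W
  ...   | d , refl = w , NewLoop.loop-closedWalk d

  cycle-transport : ∀ {C} → Old.IsCycle C → New.IsCycle C
  cycle-transport (_ , W , closed , refl) =
    proj₁ (closedWalk-transport W closed) , W , proj₂ (closedWalk-transport W closed) ,
    edgesOf-indep G G′ W

  vertsOf-agree : ∀ {x y} P → Old.SimplePath x P y → Old.vertsOf x P ≡ New.vertsOf x P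
  vertsOf-agree P path = cong (_ ∷_) (heads-agree P (OldLoop.simplePath-avoids-loop P path))

  simplePath-transport : ∀ {x y} P → Old.SimplePath x P y → New.SimplePath x P y
  simplePath-transport P path@(walk , unique) =
    walk-transport P (OldLoop.simplePath-avoids-loop P path) walk ,
    subst Unique (vertsOf-agree P path) unique

  incident-transport : ∀ {X u} → e S.∉ X → Old.Incident X u → New.Incident X u
  incident-transport e∉X (f , f∈ , ends) =
    f , f∈ , Sum.map (trans (sym (end₁-agree f f≢e))) (trans (sym (end₂-agree f f≢e))) ends
    where
    f≢e : f ≢ e
    f≢e = ∈∧∉⇒≢ f∈ e∉X

  incident-reflect : ∀ {X u} → e S.∉ X → New.Incident X u → Old.Incident X u
  incident-reflect e∉X (f , f∈ , ends) =
    f , f∈ , Sum.map (trans (end₁-agree f f≢e)) (trans (end₂-agree f f≢e)) ends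
    where
    f≢e : f ≢ e
    f≢e = ∈∧∉⇒≢ f∈ e∉X

  handcuff-transport : ∀ {C₁ C₂ X} → e S.∉ C₁ → e S.∉ C₂ →
                       Old.Handcuff C₁ C₂ X → New.Handcuff C₁ C₂ X
  handcuff-transport e∉C₁ e∉C₂
    (inj₁ (cyc₁ , cyc₂ , disjoint , (u , u∈C₁ , u∈C₂ , shared) , X≡C₁∪C₂)) =
    inj₁ (cycle-transport cyc₁ , cycle-transport cyc₂ , disjoint ,
          (u , incident-transport e∉C₁ u∈C₁ , incident-transport e∉C₂ u∈C₂ ,
           λ u′ u′∈C₁ u′∈C₂ →
             shared u′ (incident-reflect e∉C₁ u′∈C₁) (incident-reflect e∉C₂ u′∈C₂)) ,
          X≡C₁∪C₂)
  handcuff-transport {C₁} {C₂} e∉C₁ e∉C₂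
    (inj₂ (cyc₁ , cyc₂ , apart , x , P , y , path , x∈C₁ , y∈C₂ , meets₁ , meets₂ , refl)) =
    inj₂ (cycle-transport cyc₁ , cycle-transport cyc₂ ,
          (λ u u∈C₁ u∈C₂ → apart u (incident-reflect e∉C₁ u∈C₁) (incident-reflect e∉C₂ u∈C₂)) ,
          x , P , y , simplePath-transport P path ,
          incident-transport e∉C₁ x∈C₁ , incident-transport e∉C₂ y∈C₂ ,
          (λ u u∈P u∈C₁ → meets₁ u (subst (u L.∈_) (sym verts) u∈P) (incident-reflect e∉C₁ u∈C₁)) ,
          (λ u u∈P u∈C₂ → meets₂ u (subst (u L.∈_) (sym verts) u∈P) (incident-reflect e∉C₂ u∈C₂)) ,
          cong (λ Q → C₁ ∪ C₂ ∪ Q) (edgesOf-indep G G′ P))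
    where
    verts : Old.vertsOf x P ≡ New.vertsOf x P
    verts = vertsOf-agree P path

  internallyDisjoint-transport : ∀ {x y y₁ y₂} P Q →
                                 Old.SimplePath x P y₁ → Old.SimplePath x Q y₂ →
                                 Old.InternallyDisjoint x y P Q → New.InternallyDisjoint x y P Q
  internallyDisjoint-transport P Q pathP pathQ (edge-disjoint , meet) =
    subst₂ (λ X Y → ∀ f → f S.∈ X → f S.∈ Y → ⊥) (edgesOf-indep G G′ P) (edgesOf-indep G G′ Q)
           edge-disjoint ,
    λ u u∈P u∈Q → meet u (subst (u L.∈_) (sym (vertsOf-agree P pathP)) u∈P)
                         (subst (u L.∈_) (sym (vertsOf-agree Q pathQ)) u∈Q)

  theta-transport : ∀ {x y P₁ P₂ P₃ X} → Old.Theta x y P₁ P₂ P₃ X → New.Theta x y P₁ P₂ P₃ X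
  theta-transport {P₁ = P₁} {P₂} {P₃}
    (x≢y , path₁ , path₂ , path₃ , disjoint₁₂ , disjoint₁₃ , disjoint₂₃ , refl) =
    x≢y ,
    simplePath-transport P₁ path₁ , simplePath-transport P₂ path₂ , simplePath-transport P₃ path₃ ,
    internallyDisjoint-transport P₁ P₂ path₁ path₂ disjoint₁₂ ,
    internallyDisjoint-transport P₁ P₃ path₁ path₃ disjoint₁₃ ,
    internallyDisjoint-transport P₂ P₃ path₂ path₃ disjoint₂₃ ,
    cong₂ _∪_ (edgesOf-indep G G′ P₁) (cong₂ _∪_ (edgesOf-indep G G′ P₂) (edgesOf-indep G G′ P₃))

  module _ {c ℓ} (K : Group c ℓ) {φ φ′ : Fin m → Group.Carrier K}
           (φ-agree : ∀ f → f ≢ e → φ f ≡ φ′ f) where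
    open Group K using (Carrier; _≈_; _∙_; _⁻¹; ε)
      renaming (sym to ≈-sym; trans to ≈-trans)
    private
      module OldGain = GainNotions K G
      module NewGain = GainNotions K G′

    gain-agree : ∀ s → proj₁ s ≢ e → OldGain.gain φ s ≡ NewGain.gain φ′ s
    gain-agree (f , true)  f≢e = φ-agree f f≢e
    gain-agree (f , false) f≢e
      rewrite end₁-agree f f≢e | end₂-agree f f≢e | φ-agree f f≢e = refl

    walkGain-agree : ∀ W → e S.∉ Old.edgesOf W → OldGain.walkGain φ W ≡ NewGain.walkGain φ′ W
    walkGain-agree []      _  = refl
    walkGain-agree (s ∷ W) e∉ =
      cong₂ _∙_ (gain-agree s (head≢loop s W e∉)) (walkGain-agree W (tail-avoids s W e∉))

    closedWalkGain-transport : (φ e ≈ ε → φ′ e ≈ ε) → ∀ {u} W → Old.SimpleClosedWalk u W →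
                               OldGain.walkGain φ W ≈ ε → NewGain.walkGain φ′ W ≈ ε
    closedWalkGain-transport loop-balance W closed W≈ε with e ∈? Old.edgesOf W
    ... | no e∉W = subst (_≈ ε) (walkGain-agree W e∉W) W≈ε
    ... | yes e∈W with OldLoop.closedWalk-through-loop W closed e∈W
    ...   | d , refl = ≈-trans (NewLoop.walkGain-loop K φ′ d)
                         (loop-balance (≈-trans (≈-sym (OldLoop.walkGain-loop K φ d)) W≈ε))

    balanced-transport : (φ e ≈ ε → φ′ e ≈ ε) →
                         ∀ {C} → OldGain.Balanced φ C → NewGain.Balanced φ′ C
    balanced-transport loop-balance (_ , W , closed , refl , W≈ε) =
      proj₁ (closedWalk-transport W closed) , W , proj₂ (closedWalk-transport W closed) ,
      edgesOf-indep G G′ W , closedWalkGain-transport loop-balance W closed W≈ε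

    switchedInto-transport : ∀ {q} (A : Pred Carrier q) η {X} →
                             (e S.∈ X → A (η v ⁻¹ ∙ φ e ∙ η v) → A (η w ⁻¹ ∙ φ′ e ∙ η w)) →
                             OldGain.SwitchedInto φ η X A → NewGain.SwitchedInto φ′ η X A
    switchedInto-transport A η loop-into into f f∈ d with f ≟ e
    ... | yes refl =
      subst A (sym (NewLoop.switchedGain-loop K φ′ η d))
            (loop-into f∈ (subst A (OldLoop.switchedGain-loop K φ η d) (into f f∈ d)))
    ... | no f≢e = subst A switched-agree (into f f∈ d)
      where
      switched-agree : OldGain.switchedGain φ η (f , d) ≡ NewGain.switchedGain φ′ η (f , d)
      switched-agree
        rewrite tl-agree (f , d) f≢e | hd-agree (f , d) f≢e | gain-agree (f , d) f≢e = refl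

Independent-antitone : ∀ {m q} {Circuit Circuit′ : Subset m → Set q} →
                       (∀ C → Circuit′ C → Circuit C) →
                       ∀ {Y} → Independent Circuit Y → Independent Circuit′ Y
Independent-antitone fewer independent C circuit C⊆Y = independent C (fewer C circuit) C⊆Y

module _ {m q} {Circuit Circuit′ : Subset m → Set q} (same : ∀ C → Circuit C ⇔ Circuit′ C) where

  IsRank-cong : ∀ {X k} → IsRank Circuit X k → IsRank Circuit′ X k
  IsRank-cong ((Y , Y⊆X , independent , ∣Y∣≡k) , maximal) =
    (Y , Y⊆X , Independent-antitone (from ∘ same) independent , ∣Y∣≡k) ,
    λ Y′ Y′⊆X independent′ → maximal Y′ Y′⊆X (Independent-antitone (to ∘ same) independent′)

  allCircuitsIn-cong : ∀ {r} {Good Good′ : Subset m → Set r} → (∀ C → Good C ⇔ Good′ C) → ∀ {X} →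
                       (∀ C → Circuit C → C ⊆ X → Good C) ⇔ (∀ C → Circuit′ C → C ⊆ X → Good′ C)
  allCircuitsIn-cong sameGood = mk⇔
    (λ all C circuit′ C⊆X → to (sameGood C) (all C (from (same C) circuit′) C⊆X))
    (λ all′ C circuit C⊆X → from (sameGood C) (all′ C (to (same C) circuit) C⊆X))

module Construction {c ℓ p a} (Γ : Group c ℓ) (Γ₁ : Pred (Group.Carrier Γ) p)
                    (isN : IsNormalSubgroup Γ Γ₁)
                    {I : Set a} (𝒜 : I → Pred (Group.Carrier Γ) p) where
  open Group Γ hiding (refl; trans) renaming (sym to ≈-sym)
  open IsNormalSubgroup isN using (normal)
  open Quotient Γ Γ₁ isN using (quotientGroup)
  open GroupProperties Γ using (⁻¹-involutive; inverseˡ-unique)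
  open SetoidReasoning setoid

  NCircuit : ∀ {n m} → Graph n m → (Fin m → Carrier) → Subset m → Set p
  NCircuit G ψ = MNotions.NCircuit Γ Γ₁ isN 𝒜 G ψ

  𝒞 : ∀ {n m} → Graph n m → (Fin m → Carrier) → Subset m → Set (c ⊔ ℓ ⊔ p ⊔ a)
  𝒞 G ψ = MNotions.𝒞 Γ Γ₁ isN 𝒜 G ψ

  RankM : ∀ {n m} → Graph n m → (Fin m → Carrier) → Subset m → ℕ → Set (c ⊔ ℓ ⊔ p ⊔ a)
  RankM G ψ = MNotions.RankM Γ Γ₁ isN 𝒜 G ψ

  RankM-transport : ∀ {n m} {G G′ : Graph n m} {ψ ψ′} →
                    (∀ C → NCircuit G ψ C ⇔ NCircuit G′ ψ′ C) → (∀ C → 𝒞 G ψ C ⇔ 𝒞 G′ ψ′ C) →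
                    ∀ {X k} → RankM G ψ X k → RankM G′ ψ′ X k
  RankM-transport sameN same𝒞 (inj₁ (all∈𝒞 , rank)) =
    inj₁ (to (allCircuitsIn-cong sameN same𝒞) all∈𝒞 , IsRank-cong sameN rank)
  RankM-transport sameN same𝒞 (inj₂ (¬all∈𝒞 , j , rank , k≡1+j)) =
    inj₂ (¬all∈𝒞 ∘ from (allCircuitsIn-cong sameN same𝒞) , j , IsRank-cong sameN rank , k≡1+j)

  SameM-from-circuits : ∀ {n m} {G G′ : Graph n m} {ψ ψ′} →
                        (∀ C → NCircuit G ψ C ⇔ NCircuit G′ ψ′ C) →
                        (∀ C → 𝒞 G ψ C ⇔ 𝒞 G′ ψ′ C) →
                        SameM Γ Γ₁ isN 𝒜 G ψ G′ ψ′
  SameM-from-circuits sameN same𝒞 X k =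
    RankM-transport sameN same𝒞 , RankM-transport (⇔-sym ∘ sameN) (⇔-sym ∘ same𝒞)

  quotient-≈ε⇔ : ∀ {x} → Group._≈_ quotientGroup x ε ⇔ Γ₁ x
  quotient-≈ε⇔ {x} = mk⇔
    (λ x∼ε → resp (⁻¹-involutive x) (⁻¹-closed (resp (identityʳ (x ⁻¹)) x∼ε)))
    (λ x∈Γ₁ → resp (≈-sym (identityʳ (x ⁻¹))) (⁻¹-closed x∈Γ₁))
    where open IsNormalSubgroup isN using (resp; ⁻¹-closed)

  conj-≈ε : ∀ γ x → γ ⁻¹ ∙ x ∙ γ ≈ ε → x ≈ ε
  conj-≈ε γ x conj≈ε = begin
    x                ≈⟨ ≈-sym (identityˡ x) ⟩
    ε ∙ x            ≈⟨ ∙-congʳ (≈-sym (inverseʳ γ)) ⟩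
    γ ∙ γ ⁻¹ ∙ x     ≈⟨ assoc γ (γ ⁻¹) x ⟩
    γ ∙ (γ ⁻¹ ∙ x)   ≈⟨ ∙-congˡ (inverseˡ-unique (γ ⁻¹ ∙ x) γ conj≈ε) ⟩
    γ ∙ γ ⁻¹         ≈⟨ inverseʳ γ ⟩
    ε                ∎

  -- all that M can detect about the gain of a loop
  record Indistinguishable (x y : Carrier) : Set (c ⊔ ℓ ⊔ p ⊔ a) where
    field
      Γ₁-⇔   : Γ₁ x ⇔ Γ₁ y
      ≈ε-⇔   : x ≈ ε ⇔ y ≈ ε
      conj-⇔ : ∀ γ i → 𝒜 i (γ ⁻¹ ∙ x ∙ γ) ⇔ 𝒜 i (γ ⁻¹ ∙ y ∙ γ)

  Indistinguishable-sym : ∀ {x y} → Indistinguishable x y → Indistinguishable y x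
  Indistinguishable-sym x~y = record
    { Γ₁-⇔ = ⇔-sym Γ₁-⇔ ; ≈ε-⇔ = ⇔-sym ≈ε-⇔ ; conj-⇔ = λ γ i → ⇔-sym (conj-⇔ γ i) }
    where open Indistinguishable x~y

  module _ (partition : Partitions Γ Γ₁ 𝒜) where

    same-block : ∀ {x} → ¬ x ≈ ε → ∀ B B′ → member Γ Γ₁ 𝒜 B x → member Γ Γ₁ 𝒜 B′ x →
                 ∀ {y} → member Γ Γ₁ 𝒜 B y → member Γ Γ₁ 𝒜 B′ y
    same-block x≉ε B B′ x∈B x∈B′ {y} = proj₁ (proj₂ (partition _ x≉ε) B B′ x∈B x∈B′ y)

    Γ₁-indistinguishable : ∀ {x y} → Γ₁ x → ¬ x ≈ ε → Γ₁ y → ¬ y ≈ ε → Indistinguishable x y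
    Γ₁-indistinguishable x∈Γ₁ x≉ε y∈Γ₁ y≉ε = record
      { Γ₁-⇔   = mk⇔ (λ _ → y∈Γ₁) (λ _ → x∈Γ₁)
      ; ≈ε-⇔   = mk⇔ (⊥-elim ∘ x≉ε) (⊥-elim ∘ y≉ε)
      ; conj-⇔ = λ γ i → mk⇔ (conj-transfer γ i x∈Γ₁ x≉ε y∈Γ₁) (conj-transfer γ i y∈Γ₁ y≉ε x∈Γ₁)
      }
      where
      -- γ⁻¹ x γ ≉ ε lies in Γ₁ by normality, so a block 𝒜ᵢ containing it is Γ₁
      conj-transfer : ∀ γ i {x y} → Γ₁ x → ¬ x ≈ ε → Γ₁ y →
                      𝒜 i (γ ⁻¹ ∙ x ∙ γ) → 𝒜 i (γ ⁻¹ ∙ y ∙ γ)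
      conj-transfer γ i {x} {y} x∈Γ₁ x≉ε y∈Γ₁ x′∈𝒜ᵢ =
        same-block (x≉ε ∘ conj-≈ε γ x) (inj₁ tt) (inj₂ i) (normal γ x x∈Γ₁) x′∈𝒜ᵢ (normal γ y y∈Γ₁)

    module _ (𝒜-subgroups : ∀ i → IsSubgroup Γ (𝒜 i)) (conjClosed : ConjClosed Γ 𝒜) where

      𝒜-indistinguishable : ∀ {i x y} → 𝒜 i x → ¬ x ≈ ε → 𝒜 i y → ¬ y ≈ ε →
                            Indistinguishable x y
      𝒜-indistinguishable {i} x∈𝒜ᵢ x≉ε y∈𝒜ᵢ y≉ε = record
        { Γ₁-⇔   = mk⇔ (Γ₁-transfer x∈𝒜ᵢ x≉ε y∈𝒜ᵢ) (Γ₁-transfer y∈𝒜ᵢ y≉ε x∈𝒜ᵢ)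
        ; ≈ε-⇔   = mk⇔ (⊥-elim ∘ x≉ε) (⊥-elim ∘ y≉ε)
        ; conj-⇔ = λ γ j → mk⇔ (conj-transfer γ j x∈𝒜ᵢ x≉ε y∈𝒜ᵢ)
                               (conj-transfer γ j y∈𝒜ᵢ y≉ε x∈𝒜ᵢ)
        }
        where
        Γ₁-transfer : ∀ {x y} → 𝒜 i x → ¬ x ≈ ε → 𝒜 i y → Γ₁ x → Γ₁ y
        Γ₁-transfer x∈𝒜ᵢ x≉ε y∈𝒜ᵢ x∈Γ₁ = same-block x≉ε (inj₂ i) (inj₁ tt) x∈𝒜ᵢ x∈Γ₁ y∈𝒜ᵢ

        -- γ 𝒜ⱼ γ⁻¹ is some 𝒜ₖ; it contains x, so it is the block 𝒜ᵢ and contains y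
        conj-transfer : ∀ γ j {x y} → 𝒜 i x → ¬ x ≈ ε → 𝒜 i y →
                        𝒜 j (γ ⁻¹ ∙ x ∙ γ) → 𝒜 j (γ ⁻¹ ∙ y ∙ γ)
        conj-transfer γ j {x} {y} x∈𝒜ᵢ x≉ε y∈𝒜ᵢ x′∈𝒜ⱼ =
          resp (∙-congˡ (⁻¹-involutive γ)) (proj₂ (conj≡𝒜ₖ y) y∈𝒜ₖ)
          where
          open IsSubgroup (𝒜-subgroups j) using (resp)
          k : I
          k = proj₁ (conjClosed j (γ ⁻¹))
          conj≡𝒜ₖ : SameSet Γ (Conj Γ (𝒜 j) (γ ⁻¹)) (𝒜 k)
          conj≡𝒜ₖ = proj₂ (conjClosed j (γ ⁻¹))
          x∈𝒜ₖ : 𝒜 k x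
          x∈𝒜ₖ = proj₁ (conj≡𝒜ₖ x) (resp (∙-congˡ (≈-sym (⁻¹-involutive γ))) x′∈𝒜ⱼ)
          y∈𝒜ₖ : 𝒜 k y
          y∈𝒜ₖ = same-block x≉ε (inj₂ i) (inj₂ k) x∈𝒜ᵢ x∈𝒜ₖ y∈𝒜ᵢ

  module LoopGainChange {n m} {G : Graph n m} {e v} (loop : GraphNotions.IsLoopAt G e v)
                        {ψ ψ′ : Fin m → Carrier} (ψ-agree : ∀ f → f ≢ e → ψ f ≡ ψ′ f)
                        (ψe~ψ′e : Indistinguishable (ψ e) (ψ′ e)) where
    open Indistinguishable ψe~ψ′e
    open Relocation (LoopRelocation-refl {G = G} loop)
      using (balanced-transport; switchedInto-transport)
    private
      module GQ = GainNotions quotientGroup G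

      ψ′-agree : ∀ f → f ≢ e → ψ′ f ≡ ψ f
      ψ′-agree f f≢e = sym (ψ-agree f f≢e)

      Q-balanced-transport : ∀ {C} → GQ.Balanced ψ C → GQ.Balanced ψ′ C
      Q-balanced-transport =
        balanced-transport quotientGroup ψ-agree (from quotient-≈ε⇔ ∘ to Γ₁-⇔ ∘ to quotient-≈ε⇔)

      Q-unbalanced-transport : ∀ {C} → ¬ GQ.Balanced ψ C → ¬ GQ.Balanced ψ′ C
      Q-unbalanced-transport unbalanced = unbalanced ∘
        balanced-transport quotientGroup ψ′-agree (from quotient-≈ε⇔ ∘ from Γ₁-⇔ ∘ to quotient-≈ε⇔)

    NCircuit-transport : ∀ {C} → NCircuit G ψ C → NCircuit G ψ′ C
    NCircuit-transport (inj₁ (cyc , bal)) = inj₁ (cyc , Q-balanced-transport bal)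
    NCircuit-transport (inj₂ (inj₁ (C₁ , C₂ , hc , ub₁ , ub₂))) =
      inj₂ (inj₁ (C₁ , C₂ , hc , Q-unbalanced-transport ub₁ , Q-unbalanced-transport ub₂))
    NCircuit-transport (inj₂ (inj₂ (x , y , P₁ , P₂ , P₃ , θ , ub₁₂ , ub₁₃ , ub₂₃))) =
      inj₂ (inj₂ (x , y , P₁ , P₂ , P₃ , θ , Q-unbalanced-transport ub₁₂ ,
                  Q-unbalanced-transport ub₁₃ , Q-unbalanced-transport ub₂₃))

    𝒞-transport : ∀ {C} → 𝒞 G ψ C → 𝒞 G ψ′ C
    𝒞-transport (circuit , inj₁ (cyc , bal)) =
      NCircuit-transport circuit , inj₁ (cyc , balanced-transport Γ ψ-agree (to ≈ε-⇔) bal)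
    𝒞-transport (circuit , inj₂ (shape , η , i , into)) =
      NCircuit-transport circuit ,
      inj₂ (shape , η , i ,
            switchedInto-transport Γ ψ-agree (𝒜 i) η (λ _ → to (conj-⇔ (η v) i)) into)

  SameM-loopGainChange : ∀ {n m} {G : Graph n m} {e v} → GraphNotions.IsLoopAt G e v →
                         ∀ {ψ ψ′} → (∀ f → f ≢ e → ψ f ≡ ψ′ f) →
                         Indistinguishable (ψ e) (ψ′ e) → SameM Γ Γ₁ isN 𝒜 G ψ G ψ′
  SameM-loopGainChange {G = G} loop ψ-agree ψe~ψ′e =
    SameM-from-circuits (λ _ → mk⇔ Fwd.NCircuit-transport Bwd.NCircuit-transport)
                        (λ _ → mk⇔ Fwd.𝒞-transport Bwd.𝒞-transport)
    where
    module Fwd = LoopGainChange {G = G} loop ψ-agree ψe~ψ′e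
    module Bwd = LoopGainChange {G = G} loop (λ f f≢e → sym (ψ-agree f f≢e))
                                (Indistinguishable-sym ψe~ψ′e)

  module LoopRelocated {n m} {G G′ : Graph n m} {e v w} (R : LoopRelocation G G′ e v w)
                       {ψ : Fin m → Carrier} (ψe∈Γ₁ : Γ₁ (ψ e)) where
    private
      module Old  = GraphNotions G
      module New  = GraphNotions G′
      module OldQ = GainNotions quotientGroup G
      module NewQ = GainNotions quotientGroup G′
      module Fwd  = Relocation R
      module Bwd  = Relocation (LoopRelocation-sym R)
      open GraphProperties G using (handcuff-cycles; handcuff-⊆; handcuff-⊈⁅⁆; theta-⊈⁅⁆)
      open GraphProperties.Loop G (LoopRelocation.loop R)

      Q-unbalanced-cycle-avoids-loop : ∀ {C} → Old.IsCycle C → ¬ OldQ.Balanced ψ C → e S.∉ C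
      Q-unbalanced-cycle-avoids-loop cyc unbalanced e∈C =
        unbalanced (cycle-through-loop-balanced quotientGroup (from quotient-≈ε⇔ ψe∈Γ₁) cyc e∈C)

      Q-unbalanced-transport : ∀ {C} → ¬ OldQ.Balanced ψ C → ¬ NewQ.Balanced ψ C
      Q-unbalanced-transport unbalanced =
        unbalanced ∘ Bwd.balanced-transport quotientGroup (λ _ _ → refl) id

      Q-unbalanced-paths-transport : ∀ P Q → ¬ OldQ.Balanced ψ (Old.edgesOf P ∪ Old.edgesOf Q) →
                                     ¬ NewQ.Balanced ψ (New.edgesOf P ∪ New.edgesOf Q)
      Q-unbalanced-paths-transport P Q
        rewrite edgesOf-indep G′ G P | edgesOf-indep G′ G Q = Q-unbalanced-transport

      handcuff-avoids : ∀ {C₁ C₂ X} → Old.Handcuff C₁ C₂ X →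
                        ¬ OldQ.Balanced ψ C₁ → ¬ OldQ.Balanced ψ C₂ → e S.∉ C₁ × e S.∉ C₂
      handcuff-avoids hc ub₁ ub₂ =
        Q-unbalanced-cycle-avoids-loop (proj₁ (handcuff-cycles hc)) ub₁ ,
        Q-unbalanced-cycle-avoids-loop (proj₂ (handcuff-cycles hc)) ub₂

      circuit-shape-avoids-loop : ∀ {C} → NCircuit G ψ C →
                                  Old.IsHandcuff C ⊎ Old.IsTheta C → e S.∉ C
      circuit-shape-avoids-loop (inj₁ (cyc , _)) (inj₁ (_ , _ , hc)) e∈C =
        handcuff-⊈⁅⁆ hc (cycle-through-loop cyc e∈C)
      circuit-shape-avoids-loop (inj₁ (cyc , _)) (inj₂ (_ , _ , _ , _ , _ , θ)) e∈C =
        theta-⊈⁅⁆ θ (cycle-through-loop cyc e∈C)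
      circuit-shape-avoids-loop (inj₂ (inj₁ (_ , _ , hc , ub₁ , ub₂))) _ =
        handcuff-avoids-loop hc (proj₁ (handcuff-avoids hc ub₁ ub₂))
                                (proj₂ (handcuff-avoids hc ub₁ ub₂))
      circuit-shape-avoids-loop (inj₂ (inj₂ (_ , _ , _ , _ , _ , θ , _))) _ = theta-avoids-loop θ

      shape-transport : ∀ {C} → e S.∉ C →
                        Old.IsHandcuff C ⊎ Old.IsTheta C → New.IsHandcuff C ⊎ New.IsTheta C
      shape-transport e∉C (inj₁ (C₁ , C₂ , hc)) =
        inj₁ (C₁ , C₂ , Fwd.handcuff-transport (e∉C ∘ proj₁ (handcuff-⊆ hc))
                                               (e∉C ∘ proj₂ (handcuff-⊆ hc)) hc)
      shape-transport e∉C (inj₂ (x , y , P₁ , P₂ , P₃ , θ)) =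
        inj₂ (x , y , P₁ , P₂ , P₃ , Fwd.theta-transport θ)

    NCircuit-transport : ∀ {C} → NCircuit G ψ C → NCircuit G′ ψ C
    NCircuit-transport (inj₁ (cyc , bal)) =
      inj₁ (Fwd.cycle-transport cyc , Fwd.balanced-transport quotientGroup (λ _ _ → refl) id bal)
    NCircuit-transport (inj₂ (inj₁ (C₁ , C₂ , hc , ub₁ , ub₂))) =
      inj₂ (inj₁ (C₁ , C₂ , Fwd.handcuff-transport (proj₁ avoids) (proj₂ avoids) hc ,
                  Q-unbalanced-transport ub₁ , Q-unbalanced-transport ub₂))
      where
      avoids : e S.∉ C₁ × e S.∉ C₂
      avoids = handcuff-avoids hc ub₁ ub₂
    NCircuit-transport (inj₂ (inj₂ (x , y , P₁ , P₂ , P₃ , θ , ub₁₂ , ub₁₃ , ub₂₃))) =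
      inj₂ (inj₂ (x , y , P₁ , P₂ , P₃ , Fwd.theta-transport θ ,
                  Q-unbalanced-paths-transport P₁ P₂ ub₁₂ ,
                  Q-unbalanced-paths-transport P₁ P₃ ub₁₃ ,
                  Q-unbalanced-paths-transport P₂ P₃ ub₂₃))

    𝒞-transport : ∀ {C} → 𝒞 G ψ C → 𝒞 G′ ψ C
    𝒞-transport (circuit , inj₁ (cyc , bal)) =
      NCircuit-transport circuit ,
      inj₁ (Fwd.cycle-transport cyc , Fwd.balanced-transport Γ (λ _ _ → refl) id bal)
    𝒞-transport {C} (circuit , inj₂ (shape , η , i , into)) =
      NCircuit-transport circuit ,
      inj₂ (shape-transport e∉C shape , η , i ,
            Fwd.switchedInto-transport Γ (λ _ _ → refl) (𝒜 i) η (⊥-elim ∘ e∉C) into)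
      where
      e∉C : e S.∉ C
      e∉C = circuit-shape-avoids-loop circuit shape

  SameM-loopRelocation : ∀ {n m} {G G′ : Graph n m} {e v w} → LoopRelocation G G′ e v w →
                         ∀ {ψ} → Γ₁ (ψ e) → SameM Γ Γ₁ isN 𝒜 G ψ G′ ψ
  SameM-loopRelocation R {ψ} ψe∈Γ₁ =
    SameM-from-circuits (λ _ → mk⇔ Fwd.NCircuit-transport Bwd.NCircuit-transport)
                        (λ _ → mk⇔ Fwd.𝒞-transport Bwd.𝒞-transport)
    where
    module Fwd = LoopRelocated R {ψ} ψe∈Γ₁
    module Bwd = LoopRelocated (LoopRelocation-sym R) {ψ} ψe∈Γ₁

lemma3p5 : ∀ {c ℓ p a} (Γ : Group c ℓ) → let open Group Γ in
    (Γ₁ : Pred Carrier p) (isN : IsNormalSubgroup Γ Γ₁) →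
    {I : Set a} (𝒜 : I → Pred Carrier p) →
    (∀ i → IsSubgroup Γ (𝒜 i)) →
    Partitions Γ Γ₁ 𝒜 →
    (∀ i → Malnormal Γ (𝒜 i)) →
    ConjClosed Γ 𝒜 →
    ∀ {n m} (G : Graph n m) (ψ : Fin m → Carrier) (e : Fin m) (v : Fin n) →
    GraphNotions.IsLoopAt G e v →
    -- (a)
    (Γ₁ (ψ e) → ¬ (ψ e ≈ ε) →
      ∀ g → Γ₁ g → ¬ (g ≈ ε) → ¬ (g ≈ ψ e) →
      SameM Γ Γ₁ isN 𝒜 G ψ G (replaceGain ψ e g)) ×
    -- (b)
    (∀ i → 𝒜 i (ψ e) → ¬ (ψ e ≈ ε) →
      ∀ g → 𝒜 i g → ¬ (g ≈ ε) → ¬ (g ≈ ψ e) →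
      SameM Γ Γ₁ isN 𝒜 G ψ G (replaceGain ψ e g)) ×
    -- (c)
    (Γ₁ (ψ e) → ¬ (ψ e ≈ ε) →
      ∀ w → w ≢ v →
      SameM Γ Γ₁ isN 𝒜 G ψ (moveToLoop G e w) ψ)
lemma3p5 Γ Γ₁ isN 𝒜 𝒜-subgroups partition _ conjClosed G ψ e v loop =
  (λ ψe∈Γ₁ ψe≉ε g g∈Γ₁ g≉ε _ →
     SameM-replaceGain g (Γ₁-indistinguishable partition ψe∈Γ₁ ψe≉ε g∈Γ₁ g≉ε)) ,
  (λ i ψe∈𝒜ᵢ ψe≉ε g g∈𝒜ᵢ g≉ε _ →
     SameM-replaceGain g
       (𝒜-indistinguishable partition 𝒜-subgroups conjClosed ψe∈𝒜ᵢ ψe≉ε g∈𝒜ᵢ g≉ε)) ,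
  (λ ψe∈Γ₁ _ w _ → SameM-loopRelocation (moveToLoop-relocation loop w) ψe∈Γ₁)
  where
  open Construction Γ Γ₁ isN 𝒜
  SameM-replaceGain : ∀ g → Indistinguishable (ψ e) g →
                      SameM Γ Γ₁ isN 𝒜 G ψ G (replaceGain ψ e g)
  SameM-replaceGain g ψe~g =
    SameM-loopGainChange {G = G} loop (replaceGain-elsewhere ψ e g)
                         (subst (Indistinguishable (ψ e)) (sym (replaceGain-at ψ e g)) ψe~g)
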